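{- For every finite simple undirected graph $G$, $\chi(G)\leq \chi_{uc}(G)\leq 2\chi(G)-1$.
   Context: A coloring of $G=(V,E)$ is a map $c:V\to\{0,1,2,\dots\}$ with $c(u)\neq c(v)$ whenever $u,v$ are adjacent. Given $(G,c)$, a set $D\subseteq V$ is an up--color dominating $c$--set if (1) every vertex $v\notin D$ has a neighbor $d\in D$ with $c(v)<c(d)$, and (2) $D$ contains no vertex of color $0$. $\gamma_{uc}(G,c)$ is the minimum cardinality of an up--color dominating $c$--set. The chromatic up--color domination number $\chi_{uc}(G)$ is the smallest number of colors used by a coloring $c$ of $G$ with $\gamma_{uc}(G,c)=\gamma(G)$, where $\gamma(G)$ is the domination number. $\chi(G)$ is the chromatic number. -}

module Defs where

open import Data.Nat using (ℕ; zero; suc; _≤_; _<_)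
open import Data.Nat.Properties using () renaming (_≟_ to _≟ℕ_)
open import Data.Fin using (Fin)
open import Data.Fin.Subset using (Subset; _∈_; _∉_; ∣_∣)
open import Data.Bool using (Bool; true; false)
open import Data.List using (List; map; length; deduplicate)
open import Data.List.Base using ()
open import Data.Fin.Base using ()
open import Data.List using (allFin)
open import Data.Product using (Σ; ∃; ∃-syntax; _×_; _,_)
open import Relation.Binary.PropositionalEquality using (_≡_; _≢_)

record Graph (n : ℕ) : Set where
  field
    adj      : Fin n → Fin n → Bool
    symmetric : ∀ u v → adj u v ≡ adj v u
    loopless  : ∀ v → adj v v ≡ false

open Graph public

Adjacent : ∀ {n} → Graph n → Fin n → Fin n → Set
Adjacent G u v = adj G u v ≡ true

IsColoring : ∀ {n} → Graph n → (Fin n → ℕ) → Set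
IsColoring G c = ∀ u v → Adjacent G u v → c u ≢ c v

numColors : ∀ {n} → (Fin n → ℕ) → ℕ
numColors {n} c = length (deduplicate _≟ℕ_ (map c (allFin n)))

IsMinimum : (ℕ → Set) → ℕ → Set
IsMinimum P k = P k × (∀ m → P m → k ≤ m)

IsDominatingSet : ∀ {n} → Graph n → Subset n → Set
IsDominatingSet G D = ∀ v → v ∉ D → ∃[ d ] (d ∈ D × Adjacent G v d)

IsDominationNumber : ∀ {n} → Graph n → ℕ → Set
IsDominationNumber G = IsMinimum (λ k → ∃[ D ] (IsDominatingSet G D × ∣ D ∣ ≡ k))

IsUpColorDominatingSet : ∀ {n} → Graph n → (Fin n → ℕ) → Subset n → Set
IsUpColorDominatingSet G c D =
  (∀ v → v ∉ D → ∃[ d ] (d ∈ D × Adjacent G v d × c v < c d))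
  × (∀ v → v ∈ D → c v ≢ 0)

IsUpColorDominationNumber : ∀ {n} → Graph n → (Fin n → ℕ) → ℕ → Set
IsUpColorDominationNumber G c =
  IsMinimum (λ k → ∃[ D ] (IsUpColorDominatingSet G c D × ∣ D ∣ ≡ k))

IsChromaticNumber : ∀ {n} → Graph n → ℕ → Set
IsChromaticNumber G =
  IsMinimum (λ k → ∃[ c ] (IsColoring G c × numColors c ≡ k))

IsChromaticUpColorDominationNumber : ∀ {n} → Graph n → ℕ → Set
IsChromaticUpColorDominationNumber G =
  IsMinimum (λ k → ∃[ c ] (IsColoring G c × numColors c ≡ k
     × ∃[ g ] (IsDominationNumber G g × IsUpColorDominationNumber G c g)))

{-# OPTIONS --safe #-}
-- Lower bound: a coloring witnessing χ_uc(G) is in particular a proper coloring of G.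
-- Upper bound: take a proper coloring with colors 0, …, χ-1 and a minimum dominating set D.
-- Recolor each v ∈ D by χ + c v, and each v ∉ D by c v, except that color 0 becomes χ.
-- The result is proper and uses only colors 1, …, 2χ-1.  A vertex v ∉ D has a neighbor
-- d ∈ D of another old color, and the new color of d is then strictly larger: the only
-- tie χ = χ + 0 is between equal old colors.  So D is an up-color dominating set of size
-- γ(G), and since every up-color dominating set dominates, γ_uc = γ for the new coloring.
-- The minimum defining χ_uc exists constructively: replacing each color by its rank among
-- {0} ∪ c(V) preserves properness, the number of colors, the order of colors and color 0,
-- and lands in 0, …, k for a coloring with k colors, so each candidate k is a finite search.
module Submission where

open import Defs
open import Data.Nat using (ℕ; zero; suc; pred; _+_; _*_; _∸_; _≤_; _<_; _≟_; _<?_; z≤n; s≤s)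
open import Data.Nat.Properties
  using (≤-trans; ≤-antisym; <-trans; <-≤-trans; <⇒≤; <-irrefl; ≮⇒≥; <-cmp; n≮0; n≤0⇒n≡0;
         >⇒≢; m<n⇒0<n; m≤n⇒m≤1+n; m<n⇒m<1+n; m≤m+n; m<m+n; m+n≮m; +-monoʳ-<;
         +-identityʳ; +-cancelˡ-≡; suc[m]≤n⇒m≤pred[n]; pred[m∸n]≡m∸[1+n]; anyUpTo?)
open import Data.Nat.Induction using (<-rec)
open import Data.Bool using (Bool; true; false)
import Data.Bool as Bool
open import Data.Fin using (Fin; toℕ; fromℕ<)
open import Data.Fin.Properties using (any?; all?; injective⇒≤; toℕ-fromℕ<)
open import Data.Fin.Subset as Subset using (Subset; ⊤; ∣_∣)
open import Data.Fin.Subset.Properties using (_∈?_; anySubset?; ∈⊤; ∣⊤∣≡n)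
open import Data.List using (List; []; _∷_; map; length; filter; deduplicate; allFin; lookup)
open import Data.List.Properties using (filter-≐; length-map)
open import Data.List.Membership.Propositional using (_∈_)
open import Data.List.Membership.Propositional.Properties
  using (∈-map⁺; ∈-map⁻; ∈-allFin; ∈-deduplicate⁺; ∈-deduplicate⁻; ∈-lookup)
import Data.List.Relation.Unary.All as All
open import Data.List.Relation.Unary.Any using (here; there)
open import Data.List.Relation.Unary.AllPairs using (_∷_)
open import Data.List.Relation.Unary.Unique.Propositional using (Unique)
open import Data.List.Relation.Unary.Unique.DecPropositional.Properties _≟_ using (deduplicate-!)
open import Data.Vec as Vec using (Vec)
open import Data.Vec.Properties using (lookup∘tabulate)
open import Data.Product using (∃; ∃-syntax; _×_; _,_; proj₁; proj₂)
open import Function using (_∘_; _⇔_; mk⇔; Equivalence)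
open import Relation.Nullary using (Dec; yes; no; does; contradiction)
open import Relation.Nullary.Decidable using (_×-dec_; _→-dec_; ¬?; map′; dec-true; dec-false)
open import Relation.Unary using (Pred; Decidable)
open import Relation.Binary using (Rel) renaming (Decidable to Decidable₂)
open import Relation.Binary.Definitions using (DecidableEquality; tri<; tri≈; tri>)
open import Relation.Binary.PropositionalEquality

∃-minimum : {P : ℕ → Set} → Decidable P → ∀ {b} → P b → ∃ (IsMinimum P)
∃-minimum {P} P? = <-rec (λ b → P b → ∃ (IsMinimum P)) search _
  where
  search : ∀ b → (∀ {m} → m < b → P m → ∃ (IsMinimum P)) → P b → ∃ (IsMinimum P)
  search b below Pb with anyUpTo? P? b
  ... | yes (m , m<b , Pm) = below m<b Pm
  ... | no ∄m<b = b , Pb , λ m Pm → ≮⇒≥ λ m<b → ∄m<b (m , m<b , Pm)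

minimum-unique : ∀ {P a b} → IsMinimum P a → IsMinimum P b → a ≡ b
minimum-unique (Pa , a-least) (Pb , b-least) = ≤-antisym (a-least _ Pb) (b-least _ Pa)

anyVec? : ∀ {ℓ m} n {P : Pred (Vec (Fin m) n) ℓ} → Decidable P → Dec (∃ P)
anyVec? zero    P? = map′ (Vec.[] ,_) (λ { (Vec.[] , p) → p }) (P? Vec.[])
anyVec? (suc n) P? =
  map′ (λ (i , is , p) → i Vec.∷ is , p) (λ { (i Vec.∷ is , p) → i , is , p })
       (any? λ i → anyVec? n (P? ∘ (i Vec.∷_)))

module _ {a b} {A : Set a} {B : Set b} (_≟ᴮ_ : DecidableEquality B) (f : A → B) where

  filter-map : ∀ {p} {P : Pred B p} (P? : Decidable P) xs →
               filter P? (map f xs) ≡ map f (filter (P? ∘ f) xs)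
  filter-map P? [] = refl
  filter-map P? (x ∷ xs) with does (P? (f x))
  ... | true  = cong (f x ∷_) (filter-map P? xs)
  ... | false = filter-map P? xs

  deduplicate-map : ∀ xs → deduplicate _≟ᴮ_ (map f xs) ≡ map f (deduplicate (λ x y → f x ≟ᴮ f y) xs)
  deduplicate-map [] = refl
  deduplicate-map (x ∷ xs) = cong (f x ∷_) (begin
    filter (¬? ∘ (f x ≟ᴮ_)) (deduplicate _≟ᴮ_ (map f xs))
      ≡⟨ cong (filter (¬? ∘ (f x ≟ᴮ_))) (deduplicate-map xs) ⟩
    filter (¬? ∘ (f x ≟ᴮ_)) (map f (deduplicate (λ x y → f x ≟ᴮ f y) xs))
      ≡⟨ filter-map (¬? ∘ (f x ≟ᴮ_)) (deduplicate (λ x y → f x ≟ᴮ f y) xs) ⟩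
    map f (filter (λ y → ¬? (f x ≟ᴮ f y)) (deduplicate (λ x y → f x ≟ᴮ f y) xs)) ∎)
    where open ≡-Reasoning

module _ {a r s} {A : Set a} {R : Rel A r} {S : Rel A s} (R? : Decidable₂ R) (S? : Decidable₂ S)
         (R⇒S : ∀ {x y} → R x y → S x y) (S⇒R : ∀ {x y} → S x y → R x y) where

  deduplicate-≐ : ∀ xs → deduplicate R? xs ≡ deduplicate S? xs
  deduplicate-≐ [] = refl
  deduplicate-≐ (x ∷ xs) = cong (x ∷_) (trans
    (filter-≐ (¬? ∘ R? x) (¬? ∘ S? x) ((λ ¬R S → ¬R (S⇒R S)) , (λ ¬S R → ¬S (R⇒S R)))
              (deduplicate R? xs))
    (cong (filter (¬? ∘ S? x)) (deduplicate-≐ xs)))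

lookup-injective : ∀ {a} {A : Set a} {xs : List A} → Unique xs →
                   ∀ {i j} → lookup xs i ≡ lookup xs j → i ≡ j
lookup-injective (_    ∷ _)   {Fin.zero}  {Fin.zero}  _  = refl
lookup-injective (x≢xs ∷ _)   {Fin.zero}  {Fin.suc j} eq = contradiction eq (All.lookup x≢xs (∈-lookup j))
lookup-injective (x≢xs ∷ _)   {Fin.suc i} {Fin.zero}  eq = contradiction (sym eq) (All.lookup x≢xs (∈-lookup i))
lookup-injective (_    ∷ xs!) {Fin.suc i} {Fin.suc j} eq = cong Fin.suc (lookup-injective xs! eq)

Unique∧<⇒length≤ : ∀ {m} {xs : List ℕ} → Unique xs → (∀ {x} → x ∈ xs → x < m) → length xs ≤ m
Unique∧<⇒length≤ xs! xs<m = injective⇒≤ {f = λ i → fromℕ< (xs<m (∈-lookup i))} λ eq →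
  lookup-injective xs! (trans (sym (toℕ-fromℕ< _)) (trans (cong toℕ eq) (toℕ-fromℕ< _)))

rank : List ℕ → ℕ → ℕ
rank []       x = 0
rank (z ∷ zs) x with z <? x
... | yes _ = suc (rank zs x)
... | no _  = rank zs x

rank≤length : ∀ x xs → rank xs x ≤ length xs
rank≤length x [] = z≤n
rank≤length x (z ∷ zs) with z <? x
... | yes _ = s≤s (rank≤length x zs)
... | no _  = m≤n⇒m≤1+n (rank≤length x zs)

rank<length : ∀ {x xs} → x ∈ xs → rank xs x < length xs
rank<length {x} {z ∷ zs} x∈xs with z <? x | x∈xs
... | yes z<x | here refl  = contradiction z<x (<-irrefl refl)
... | yes _   | there x∈zs = s≤s (rank<length x∈zs)
... | no _    | here refl  = s≤s (rank≤length x zs)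
... | no _    | there x∈zs = m<n⇒m<1+n (rank<length x∈zs)

rank-mono : ∀ {x y} → x ≤ y → ∀ xs → rank xs x ≤ rank xs y
rank-mono x≤y [] = z≤n
rank-mono {x} {y} x≤y (z ∷ zs) with z <? x | z <? y
... | yes _   | yes _  = s≤s (rank-mono x≤y zs)
... | yes z<x | no z≮y = contradiction (<-≤-trans z<x x≤y) z≮y
... | no _    | yes _  = m≤n⇒m≤1+n (rank-mono x≤y zs)
... | no _    | no _   = rank-mono x≤y zs

rank-strict : ∀ {x y xs} → x ∈ xs → x < y → rank xs x < rank xs y
rank-strict {x} {y} {z ∷ zs} x∈xs x<y with z <? x | z <? y | x∈xs
... | yes z<x | no z≮y | _          = contradiction (<-trans z<x x<y) z≮y
... | yes z<x | _      | here refl  = contradiction z<x (<-irrefl refl)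
... | yes _   | yes _  | there x∈zs = s≤s (rank-strict x∈zs x<y)
... | no _    | yes _  | here refl  = s≤s (rank-mono (<⇒≤ x<y) zs)
... | no _    | yes _  | there x∈zs = m<n⇒m<1+n (rank-strict x∈zs x<y)
... | no _    | no z≮y | here refl  = contradiction x<y z≮y
... | no _    | no _   | there x∈zs = rank-strict x∈zs x<y

rank-injective : ∀ {x y xs} → x ∈ xs → y ∈ xs → rank xs x ≡ rank xs y → x ≡ y
rank-injective {x} {y} x∈xs y∈xs eq with <-cmp x y
... | tri< x<y _ _ = contradiction eq (λ eq → <-irrefl eq (rank-strict x∈xs x<y))
... | tri≈ _ x≡y _ = x≡y
... | tri> _ _ y<x = contradiction (sym eq) (λ eq → <-irrefl eq (rank-strict y∈xs y<x))

module _ {n : ℕ} where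

  colors : (Fin n → ℕ) → List ℕ
  colors c = deduplicate _≟_ (map c (allFin n))

  ∈-colors : ∀ c v → c v ∈ colors c
  ∈-colors c v = ∈-deduplicate⁺ _≟_ (∈-map⁺ c (∈-allFin v))

  numColors≡length-deduplicate : ∀ c → numColors c ≡ length (deduplicate (λ u v → c u ≟ c v) (allFin n))
  numColors≡length-deduplicate c =
    trans (cong length (deduplicate-map _≟_ c (allFin n)))
          (length-map c (deduplicate (λ u v → c u ≟ c v) (allFin n)))

  numColors-cong : ∀ {c c′ : Fin n → ℕ} → (∀ {u v} → c u ≡ c v → c′ u ≡ c′ v) →
                   (∀ {u v} → c′ u ≡ c′ v → c u ≡ c v) → numColors c ≡ numColors c′
  numColors-cong {c} {c′} c⇒c′ c′⇒c = begin
    numColors c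
      ≡⟨ numColors≡length-deduplicate c ⟩
    length (deduplicate (λ u v → c u ≟ c v) (allFin n))
      ≡⟨ cong length (deduplicate-≐ _ _ c⇒c′ c′⇒c (allFin n)) ⟩
    length (deduplicate (λ u v → c′ u ≟ c′ v) (allFin n))
      ≡⟨ numColors≡length-deduplicate c′ ⟨
    numColors c′
      ∎
    where open ≡-Reasoning

  numColors-≤ : ∀ {c m} → (∀ v → c v < m) → numColors c ≤ m
  numColors-≤ {c} c<m = Unique∧<⇒length≤ (deduplicate-! (map c (allFin n))) λ x∈colors →
    let v , _ , x≡cv = ∈-map⁻ c (∈-deduplicate⁻ _≟_ (map c (allFin n)) x∈colors)
    in subst (_< _) (sym x≡cv) (c<m v)

  numColors-≤-positive : ∀ {c m} → (∀ v → 0 < c v × c v ≤ m) → numColors c ≤ m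
  numColors-≤-positive {c} c∈[1,m] =
    subst (_≤ _) (sym (numColors-cong (cong pred) pred-injective)) (numColors-≤ (pred< ∘ c∈[1,m]))
    where
    pred-injective : ∀ {u v} → pred (c u) ≡ pred (c v) → c u ≡ c v
    pred-injective {u} {v} with c u | c v | c∈[1,m] u | c∈[1,m] v
    ... | suc _ | suc _ | _ | _ = cong suc
    pred< : ∀ {x m} → 0 < x × x ≤ m → pred x < m
    pred< {suc x} (_ , x<m) = x<m

module _ {n} (G : Graph n) where

  IsColoring? : Decidable (IsColoring G)
  IsColoring? c = all? λ u → all? λ v → (adj G u v Bool.≟ true) →-dec ¬? (c u ≟ c v)

  IsDominatingSet? : Decidable (IsDominatingSet G)
  IsDominatingSet? D = all? λ v → ¬? (v ∈? D) →-dec any? λ d → (d ∈? D) ×-dec (adj G v d Bool.≟ true)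

  IsUpColorDominatingSet? : ∀ c → Decidable (IsUpColorDominatingSet G c)
  IsUpColorDominatingSet? c D =
    (all? λ v → ¬? (v ∈? D) →-dec
                any? λ d → (d ∈? D) ×-dec (adj G v d Bool.≟ true) ×-dec (c v <? c d))
    ×-dec (all? λ v → (v ∈? D) →-dec ¬? (c v ≟ 0))

  upColorDominating⇒dominating : ∀ {c D} → IsUpColorDominatingSet G c D → IsDominatingSet G D
  upColorDominating⇒dominating (up , _) v v∉D = let d , d∈D , v~d , _ = up v v∉D in d , d∈D , v~d

  dominationNumber : ∃ (IsDominationNumber G)
  dominationNumber = ∃-minimum (λ k → anySubset? λ D → IsDominatingSet? D ×-dec (∣ D ∣ ≟ k))
                               (⊤ , (λ v v∉⊤ → contradiction ∈⊤ v∉⊤) , ∣⊤∣≡n n)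

  UpColorDominatingSetOfSize : (Fin n → ℕ) → ℕ → Set
  UpColorDominatingSetOfSize c k = ∃[ D ] (IsUpColorDominatingSet G c D × ∣ D ∣ ≡ k)

  UpColorDominatingSetOfSize? : ∀ c k → Dec (UpColorDominatingSetOfSize c k)
  UpColorDominatingSetOfSize? c k = anySubset? λ D → IsUpColorDominatingSet? c D ×-dec (∣ D ∣ ≟ k)

  IsUpColorOptimal : (Fin n → ℕ) → Set
  IsUpColorOptimal c = ∃[ g ] (IsDominationNumber G g × IsUpColorDominationNumber G c g)

  isUpColorOptimal⇔ : ∀ {γ c} → IsDominationNumber G γ →
                      IsUpColorOptimal c ⇔ UpColorDominatingSetOfSize c γ
  isUpColorOptimal⇔ γ-min = mk⇔
    (λ (g , g-min , (D , D-ucds , |D|≡g) , _) → D , D-ucds , trans |D|≡g (minimum-unique g-min γ-min))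
    (λ D-of-size-γ → _ , γ-min , D-of-size-γ ,
      λ m (D , D-ucds , |D|≡m) → proj₂ γ-min m (D , upColorDominating⇒dominating D-ucds , |D|≡m))

module Relabelling {n} {c c′ : Fin n → ℕ} {xs : List ℕ}
                   (c∈xs : ∀ v → c v ∈ xs) (c′≡rank : ∀ v → c′ v ≡ rank xs (c v)) where

  ≡-reflecting : ∀ {u v} → c′ u ≡ c′ v → c u ≡ c v
  ≡-reflecting {u} {v} eq =
    rank-injective (c∈xs u) (c∈xs v) (trans (sym (c′≡rank u)) (trans eq (c′≡rank v)))

  ≡-preserving : ∀ {u v} → c u ≡ c v → c′ u ≡ c′ v
  ≡-preserving {u} {v} eq = trans (c′≡rank u) (trans (cong (rank xs) eq) (sym (c′≡rank v)))

  <-preserving : ∀ {u v} → c u < c v → c′ u < c′ v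
  <-preserving {u} {v} lt = subst₂ _<_ (sym (c′≡rank u)) (sym (c′≡rank v)) (rank-strict (c∈xs u) lt)

  0-reflecting : 0 ∈ xs → ∀ v → c′ v ≡ 0 → c v ≡ 0
  0-reflecting 0∈xs v c′v≡0 = n≤0⇒n≡0 (≮⇒≥ λ 0<cv →
    n≮0 (subst (rank xs 0 <_) (trans (sym (c′≡rank v)) c′v≡0) (rank-strict 0∈xs 0<cv)))

  numColors-≡ : numColors c′ ≡ numColors c
  numColors-≡ = numColors-cong {c = c′} {c′ = c} ≡-reflecting ≡-preserving

  isColoring : ∀ G → IsColoring G c → IsColoring G c′
  isColoring G c-col u v u~v = c-col u v u~v ∘ ≡-reflecting

  isUpColorDominatingSet : 0 ∈ xs → ∀ G {D} → IsUpColorDominatingSet G c D → IsUpColorDominatingSet G c′ D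
  isUpColorDominatingSet 0∈xs G (up , nonzero) =
    (λ v v∉D → let d , d∈D , v~d , cv<cd = up v v∉D in d , d∈D , v~d , <-preserving cv<cd) ,
    (λ v v∈D → nonzero v v∈D ∘ 0-reflecting 0∈xs v)

module Compression {n} (c : Fin n → ℕ) where

  rank<suc[numColors] : ∀ v → rank (0 ∷ colors c) (c v) < suc (numColors c)
  rank<suc[numColors] v = rank<length (there (∈-colors c v))

  compressed : Vec (Fin (suc (numColors c))) n
  compressed = Vec.tabulate λ v → fromℕ< (rank<suc[numColors] v)

  open Relabelling {c′ = toℕ ∘ Vec.lookup compressed} (there ∘ ∈-colors c)
    (λ v → trans (cong toℕ (lookup∘tabulate _ v)) (toℕ-fromℕ< (rank<suc[numColors] v))) public

module _ {n} (G : Graph n) where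

  UpColorOptimalColoring : ℕ → Set
  UpColorOptimalColoring k = ∃[ c ] (IsColoring G c × numColors c ≡ k × IsUpColorOptimal G c)

  UpColorOptimalColoring? : Decidable UpColorOptimalColoring
  UpColorOptimalColoring? k =
    map′ (λ (v , c-col , c-k , D-of-size-γ) → _ , c-col , c-k , Equivalence.from optimal⇔ D-of-size-γ)
         compress
      (anyVec? n λ v → IsColoring? G (coloring v) ×-dec (numColors (coloring v) ≟ k)
                       ×-dec UpColorDominatingSetOfSize? G (coloring v) γ)
    where
    coloring : Vec (Fin (suc k)) n → Fin n → ℕ
    coloring v = toℕ ∘ Vec.lookup v

    γ = proj₁ (dominationNumber G)
    optimal⇔ : ∀ {c} → IsUpColorOptimal G c ⇔ UpColorDominatingSetOfSize G c γ
    optimal⇔ = isUpColorOptimal⇔ G (proj₂ (dominationNumber G))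

    compress : UpColorOptimalColoring k →
               ∃[ v ] (IsColoring G (coloring v) × numColors (coloring v) ≡ k ×
                       UpColorDominatingSetOfSize G (coloring v) γ)
    compress (c , c-col , refl , c-optimal) =
      let D , D-ucds , |D|≡γ = Equivalence.to optimal⇔ c-optimal
      in compressed , isColoring G c-col , numColors-≡ , D , isUpColorDominatingSet (here refl) G D-ucds , |D|≡γ
      where open Compression c

zeroTo : ℕ → ℕ → ℕ
zeroTo k zero    = k
zeroTo k (suc x) = suc x

shade : ℕ → Bool → ℕ → ℕ
shade k true  x = k + x
shade k false x = zeroTo k x

zeroTo<+ : ∀ {k x y} → x < k → x ≢ y → zeroTo k x < k + y
zeroTo<+ {k} {zero}  {zero}  _   0≢0 = contradiction refl 0≢0
zeroTo<+ {k} {zero}  {suc y} _   _   = m<m+n k (s≤s z≤n)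
zeroTo<+ {k} {suc x} {y}     x<k _   = <-≤-trans x<k (m≤m+n k y)

+≡zeroTo⇒≡ : ∀ {k x y} → y < k → k + x ≡ zeroTo k y → x ≡ y
+≡zeroTo⇒≡ {k} {x} {zero}  _   eq = +-cancelˡ-≡ k x 0 (trans eq (sym (+-identityʳ k)))
+≡zeroTo⇒≡ {k} {x} {suc y} y<k eq = contradiction (subst (_< k) (sym eq) y<k) (m+n≮m k x)

shade-injective : ∀ {k x y} b b′ → x < k → y < k → shade k b x ≡ shade k b′ y → x ≡ y
shade-injective {k} {x} {y} true  true  _   _   eq = +-cancelˡ-≡ k x y eq
shade-injective             true  false _   y<k eq = +≡zeroTo⇒≡ y<k eq
shade-injective             false true  x<k _   eq = sym (+≡zeroTo⇒≡ x<k (sym eq))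
shade-injective {k} {zero}  {zero}  false false _   _   _  = refl
shade-injective {k} {zero}  {suc y} false false _   y<k eq = contradiction (subst (_< k) (sym eq) y<k) (<-irrefl refl)
shade-injective {k} {suc x} {zero}  false false x<k _   eq = contradiction (subst (_< k) eq x<k) (<-irrefl refl)
shade-injective {k} {suc x} {suc y} false false _   _   eq = eq

shade-positive : ∀ {k x} b → x < k → 0 < shade k b x
shade-positive {k} {x}     true  x<k = <-≤-trans (m<n⇒0<n x<k) (m≤m+n k x)
shade-positive {k} {zero}  false 0<k = 0<k
shade-positive {k} {suc x} false _   = s≤s z≤n

shade<2* : ∀ {k x} b → x < k → shade k b x < 2 * k
shade<2* {k} {x}     true  x<k = subst (k + x <_) (cong (k +_) (sym (+-identityʳ k))) (+-monoʳ-< k x<k)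
shade<2* {k} {zero}  false 0<k = subst (_< 2 * k) (+-identityʳ k) (shade<2* true 0<k)
shade<2* {k} {suc x} false x<k = <-≤-trans x<k (m≤m+n k (k + 0))

shade-range : ∀ {k x} b → x < k → 0 < shade k b x × shade k b x ≤ 2 * k ∸ 1
shade-range {k} {x} b x<k = shade-positive b x<k ,
  subst (shade k b x ≤_) (pred[m∸n]≡m∸[1+n] (2 * k) 0) (suc[m]≤n⇒m≤pred[n] (shade<2* b x<k))

module UpColoring {n} (G : Graph n) {χ} {c : Fin n → ℕ} {D : Subset n}
                  (c-col : IsColoring G c) (c<χ : ∀ v → c v < χ) (D-dom : IsDominatingSet G D) where

  c⁺ : Fin n → ℕ
  c⁺ v = shade χ (does (v ∈? D)) (c v)

  range : ∀ v → 0 < c⁺ v × c⁺ v ≤ 2 * χ ∸ 1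
  range v = shade-range (does (v ∈? D)) (c<χ v)

  isColoring : IsColoring G c⁺
  isColoring u v u~v eq = c-col u v u~v (shade-injective (does (u ∈? D)) (does (v ∈? D)) (c<χ u) (c<χ v) eq)

  isUpColorDominatingSet : IsUpColorDominatingSet G c⁺ D
  isUpColorDominatingSet = up , λ v _ → >⇒≢ (proj₁ (range v))
    where
    up : ∀ v → v Subset.∉ D → ∃[ d ] (d Subset.∈ D × Adjacent G v d × c⁺ v < c⁺ d)
    up v v∉D =
      let d , d∈D , v~d = D-dom v v∉D
      in d , d∈D , v~d , subst₂ _<_ (cong (λ b → shade χ b (c v)) (sym (dec-false (v ∈? D) v∉D)))
                                    (cong (λ b → shade χ b (c d)) (sym (dec-true (d ∈? D) d∈D)))
                                    (zeroTo<+ (c<χ v) (c-col v d v~d))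

upColorOptimalColoring≤2χ∸1 : ∀ {n} (G : Graph n) {χ} → IsChromaticNumber G χ →
  ∃[ c ] (IsColoring G c × numColors c ≤ 2 * χ ∸ 1 × IsUpColorOptimal G c)
upColorOptimalColoring≤2χ∸1 G ((c₀ , c₀-col , refl) , _) =
  let γ , γ-min = dominationNumber G
      (D , D-dom , |D|≡γ) , _ = γ-min
      open UpColoring G (Relabelling.isColoring {c = c₀} (∈-colors c₀) (λ _ → refl) G c₀-col)
                        (rank<length ∘ ∈-colors c₀) D-dom
  in c⁺ , isColoring , numColors-≤-positive range ,
     Equivalence.from (isUpColorOptimal⇔ G γ-min) (D , isUpColorDominatingSet , |D|≡γ)

corollary1 : ∀ {n} (G : Graph n) (χ : ℕ) → IsChromaticNumber G χ →
    ∃[ χuc ] (IsChromaticUpColorDominationNumber G χuc × χ ≤ χuc × χuc ≤ 2 * χ ∸ 1)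
corollary1 G χ χ-min =
  let c , c-col , c≤2χ∸1 , c-optimal = upColorOptimalColoring≤2χ∸1 G χ-min
      c-witness = c , c-col , refl , c-optimal
      χuc , χuc-min = ∃-minimum (UpColorOptimalColoring? G) c-witness
      (c′ , c′-col , c′-χuc , _) , χuc-least = χuc-min
  in χuc , χuc-min ,
     proj₂ χ-min χuc (c′ , c′-col , c′-χuc) ,
     ≤-trans (χuc-least _ c-witness) c≤2χ∸1
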